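{- Let $A:\mathbb{N}\to\mathbb{N}$ (Quet's sequence) be defined by $A(0)=0$, $A(1)=1$, and, for $m\ge 2$, $A(m)$ is the least natural number such that $A(m)\notin\{A(0),A(1),\ldots,A(m-1)\}$ and $\sum_{0\le i\le m} A(i)$ is divisible by $m-1$. Then $A$ is a permutation of $\mathbb{N}$, i.e., a bijection $\mathbb{N}\to\mathbb{N}$.
   Context: $\mathbb{N}=\{0,1,2,\ldots\}$. The sequence $A$ begins $0,1,2,3,6,4,9,5,12,14,7,17,8,20,22,10,25,11,28,\ldots$; it is $(\text{A125147}(n-1))_{n\ge0}$ in the OEIS, called $A_{ -1}$ in the paper. -}

module Defs where

open import Data.Nat using (ℕ; zero; suc; _+_; _∸_; _<_; _≥_)
open import Data.Nat.Divisibility using (_∣_)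
open import Data.Product using (_×_)
open import Relation.Binary.PropositionalEquality using (_≡_; _≢_)
open import Relation.Nullary using (¬_)

partialSum : (ℕ → ℕ) → ℕ → ℕ
partialSum A zero    = 0
partialSum A (suc m) = partialSum A m + A m

Admissible : (ℕ → ℕ) → ℕ → ℕ → Set
Admissible A m x = (∀ i → i < m → A i ≢ x) × ((m ∸ 1) ∣ (partialSum A m + x))

IsQuet : (ℕ → ℕ) → Set
IsQuet A = (A 0 ≡ 0) × (A 1 ≡ 1) ×
  (∀ m → m ≥ 2 → Admissible A m (A m) × (∀ x → x < A m → ¬ Admissible A m x))

{-# OPTIONS --safe #-}
-- From position k = 5 on there is a gap c < k with A 0 + ⋯ + A k + c = k · c and all of
-- A 0, …, A k below c + k.  An admissible value x for position k + 1 has k ∣ A 0 + ⋯ + A k + x,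
-- i.e. x ≡ c (mod k), so the least one is c when c is still unused and c + k (which is fresh)
-- otherwise.  Either way the invariant persists, with the gap staying at c or growing to c + 1.
-- Taking c makes it used at the next step, so the gap never stays twice in a row and runs
-- through every number ≥ 4; each gap value either already occurs or is the next term.
-- Injectivity is built into admissibility, and existence comes from running the same recursion.
module Submission where

open import Defs
open import Data.Nat
open import Data.Nat.Properties
open import Data.Nat.Divisibility
open import Data.Nat.Tactic.RingSolver using (solve-∀)
open import Data.Product using (_×_; ∃; _,_; proj₁; proj₂)
open import Data.Sum using (inj₁; inj₂)
open import Function.Base using (_∘_)
open import Function.Definitions using (Bijective; Injective; Surjective; StrictlySurjective)
open import Function.Consequences.Propositional using (strictlySurjective⇒surjective)
open import Relation.Binary.Definitions using (tri<; tri≈; tri>)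
open import Relation.Binary.PropositionalEquality
  using (_≡_; _≢_; refl; sym; trans; cong; cong₂; subst; module ≡-Reasoning)
open import Relation.Nullary using (¬_; Dec; yes; no; contradiction)
open import Relation.Nullary.Decidable using (from-yes; map′; _×-dec_; ¬?)

private variable
  A B : ℕ → ℕ
  k m n c v x y : ℕ

multiple-below⇒≡0 : ∀ {k d} → k ∣ d → d < k → d ≡ 0
multiple-below⇒≡0 {d = zero}  _   _   = refl
multiple-below⇒≡0 {d = suc _} k∣d d<k = contradiction k∣d (>⇒∤ d<k)

≤-close-residues⇒≡ : ∀ {k a x y} → y ≤ x → k ∣ a + y → k ∣ a + x → x < y + k → x ≡ y
≤-close-residues⇒≡ {k} {a} {x} {y} y≤x k∣a+y k∣a+x x<y+k
  with d , refl ← m≤n⇒∃[o]m+o≡n y≤x = trans (cong (y +_) d≡0) (+-identityʳ y)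
  where
  d≡0 : d ≡ 0
  d≡0 = multiple-below⇒≡0
    (∣m+n∣m⇒∣n (subst (k ∣_) (sym (+-assoc a y d)) k∣a+x) k∣a+y)
    (+-cancelˡ-< y d k x<y+k)

close-residues⇒≡ : ∀ {k a x y} → k ∣ a + x → k ∣ a + y → x < y + k → y < x + k → x ≡ y
close-residues⇒≡ k∣a+x k∣a+y x<y+k y<x+k with ≤-total _ _
... | inj₁ y≤x = ≤-close-residues⇒≡ y≤x k∣a+y k∣a+x x<y+k
... | inj₂ x≤y = sym (≤-close-residues⇒≡ x≤y k∣a+x k∣a+y y<x+k)

suc-closed⇒attains-above : (g : ℕ → ℕ) → (∀ j → ∃ λ j′ → g j′ ≡ suc (g j)) → ∀ d → ∃ λ j → g j ≡ g 0 + d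
suc-closed⇒attains-above g suc-closed zero = 0 , sym (+-identityʳ (g 0))
suc-closed⇒attains-above g suc-closed (suc d)
  with j , gj≡g0+d ← suc-closed⇒attains-above g suc-closed d
  with j′ , gj′≡1+gj ← suc-closed j = j′ , trans gj′≡1+gj (trans (cong suc gj≡g0+d) (sym (+-suc (g 0) d)))

Used : (ℕ → ℕ) → ℕ → ℕ → Set
Used A m x = ∃ λ i → i < m × A i ≡ x

used? : ∀ A m x → Dec (Used A m x)
used? A m x = anyUpTo? (λ i → A i ≟ x) m

admissible? : ∀ A m x → Dec (Admissible A m x)
admissible? A m x = map′
  (λ (unused , m-1∣) → (λ i i<m Ai≡x → unused (i , i<m , Ai≡x)) , m-1∣)
  (λ (fresh , m-1∣) → (λ (i , i<m , Ai≡x) → fresh i i<m Ai≡x) , m-1∣)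
  (¬? (used? A m x) ×-dec (m ∸ 1) ∣? partialSum A m + x)

IsLeastAdmissible : (ℕ → ℕ) → ℕ → ℕ → Set
IsLeastAdmissible A m v = Admissible A m v × (∀ x → x < v → ¬ Admissible A m x)

isLeastAdmissible? : ∀ A m v → Dec (IsLeastAdmissible A m v)
isLeastAdmissible? A m v = admissible? A m v ×-dec
  map′ (λ below x → below {x}) (λ below {x} → below x) (allUpTo? (λ x → ¬? (admissible? A m x)) v)

AgreeBelow : (ℕ → ℕ) → (ℕ → ℕ) → ℕ → Set
AgreeBelow A B m = ∀ {i} → i < m → A i ≡ B i

agreeBelow-sym : AgreeBelow A B m → AgreeBelow B A m
agreeBelow-sym A≗B i<m = sym (A≗B i<m)

agreeBelow-≤ : n ≤ m → AgreeBelow A B m → AgreeBelow A B n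
agreeBelow-≤ n≤m A≗B i<n = A≗B (<-≤-trans i<n n≤m)

agreeBelow-suc : AgreeBelow A B m → A m ≡ B m → AgreeBelow A B (suc m)
agreeBelow-suc A≗B Am≡Bm i<1+m with m<1+n⇒m<n∨m≡n i<1+m
... | inj₁ i<m  = A≗B i<m
... | inj₂ refl = Am≡Bm

partialSum-cong : AgreeBelow A B m → partialSum A m ≡ partialSum B m
partialSum-cong {m = zero}  A≗B = refl
partialSum-cong {m = suc m} A≗B = cong₂ _+_ (partialSum-cong (agreeBelow-≤ (n≤1+n m) A≗B)) (A≗B ≤-refl)

used-cong : AgreeBelow A B m → Used B m x → Used A m x
used-cong A≗B (i , i<m , Bi≡x) = i , i<m , trans (A≗B i<m) Bi≡x

admissible-cong : AgreeBelow A B m → Admissible B m x → Admissible A m x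
admissible-cong {m = m} {x = x} A≗B (fresh , m-1∣) =
  (λ i i<m Ai≡x → fresh i i<m (trans (sym (A≗B i<m)) Ai≡x)) ,
  subst (λ s → (m ∸ 1) ∣ s + x) (sym (partialSum-cong A≗B)) m-1∣

isLeastAdmissible-cong : AgreeBelow A B m → IsLeastAdmissible B m v → IsLeastAdmissible A m v
isLeastAdmissible-cong A≗B (admissible , least) =
  admissible-cong A≗B admissible ,
  λ x x<v → least x x<v ∘ admissible-cong (agreeBelow-sym A≗B)

record Invariant (A : ℕ → ℕ) (k c : ℕ) : Set where
  field
    sum≡    : partialSum A (suc k) + c ≡ k * c
    c<k     : c < k
    bounded : ∀ {i} → i < suc k → A i < c + k

-- Under Invariant A k c: the least admissible value at position k + 1, paired with the next gap.
next : (ℕ → ℕ) → ℕ → ℕ → ℕ × ℕ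
next A k c with used? A (suc k) c
... | yes _ = c + k , suc c
... | no  _ = c , c

next-jump : Used A (suc k) c → next A k c ≡ (c + k , suc c)
next-jump {A} {k} {c} used with used? A (suc k) c
... | yes _     = refl
... | no unused = contradiction used unused

next-stay : ¬ Used A (suc k) c → next A k c ≡ (c , c)
next-stay {A} {k} {c} unused with used? A (suc k) c
... | yes used = contradiction used unused
... | no _     = refl

next-cong : AgreeBelow A B (suc k) → next A k c ≡ next B k c
next-cong {A} {B} {k} {c} A≗B with used? B (suc k) c
... | yes used  = next-jump (used-cong A≗B used)
... | no unused = next-stay (unused ∘ used-cong (agreeBelow-sym A≗B))

module _ (inv : Invariant A k c) where
  open Invariant inv

  gap-divides : k ∣ partialSum A (suc k) + c
  gap-divides = subst (k ∣_) (sym sum≡) (m∣m*n c)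

  divides⇒gap : x < c + k → k ∣ partialSum A (suc k) + x → x ≡ c
  divides⇒gap {x} x<c+k k∣ = close-residues⇒≡ k∣ gap-divides x<c+k (<-≤-trans c<k (m≤n+m k x))

  next-isLeastAdmissible : IsLeastAdmissible A (suc k) (proj₁ (next A k c))
  next-isLeastAdmissible with used? A (suc k) c
  ... | yes (j , j<1+k , Aj≡c) = (fresh , k∣) , least
    where
    fresh : ∀ i → i < suc k → A i ≢ c + k
    fresh i i<1+k Ai≡c+k = <-irrefl Ai≡c+k (bounded i<1+k)
    k∣ : k ∣ partialSum A (suc k) + (c + k)
    k∣ = subst (k ∣_) (trans (cong (_+ k) (sym sum≡)) (+-assoc _ c k)) (∣m∣n⇒∣m+n (m∣m*n c) ∣-refl)
    least : ∀ x → x < c + k → ¬ Admissible A (suc k) x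
    least x x<c+k (fresh , k∣) = fresh j j<1+k (trans Aj≡c (sym (divides⇒gap x<c+k k∣)))
  ... | no unused = ((λ i i<1+k Ai≡c → unused (i , i<1+k , Ai≡c)) , gap-divides) , least
    where
    least : ∀ x → x < c → ¬ Admissible A (suc k) x
    least x x<c (_ , k∣) = <-irrefl (divides⇒gap (<-≤-trans x<c (m≤m+n c k)) k∣) x<c

  stay-invariant : A (suc k) ≡ c → Invariant A (suc k) c
  stay-invariant A[1+k]≡c = record { sum≡ = sum≡′ ; c<k = m<n⇒m<1+n c<k ; bounded = bounded′ }
    where
    open ≡-Reasoning
    sum≡′ : partialSum A (suc k) + A (suc k) + c ≡ suc k * c
    sum≡′ = begin
      partialSum A (suc k) + A (suc k) + c ≡⟨ cong (λ a → partialSum A (suc k) + a + c) A[1+k]≡c ⟩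
      partialSum A (suc k) + c + c         ≡⟨ cong (_+ c) sum≡ ⟩
      k * c + c                            ≡⟨ +-comm (k * c) c ⟩
      suc k * c                            ∎
    bounded′ : ∀ {i} → i < suc (suc k) → A i < c + suc k
    bounded′ i<2+k with m<1+n⇒m<n∨m≡n i<2+k
    ... | inj₁ i<1+k = <-≤-trans (bounded i<1+k) (+-monoʳ-≤ c (n≤1+n k))
    ... | inj₂ refl  = subst (_< c + suc k) (sym A[1+k]≡c) (m<m+n c z<s)

  jump-invariant : A (suc k) ≡ c + k → Invariant A (suc k) (suc c)
  jump-invariant A[1+k]≡c+k = record { sum≡ = sum≡′ ; c<k = s≤s c<k ; bounded = bounded′ }
    where
    open ≡-Reasoning
    expand : ∀ k c → k * c + k + suc c ≡ suc k * suc c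
    expand = solve-∀
    sum≡′ : partialSum A (suc k) + A (suc k) + suc c ≡ suc k * suc c
    sum≡′ = begin
      partialSum A (suc k) + A (suc k) + suc c ≡⟨ cong (λ a → partialSum A (suc k) + a + suc c) A[1+k]≡c+k ⟩
      partialSum A (suc k) + (c + k) + suc c   ≡⟨ cong (_+ suc c) (+-assoc (partialSum A (suc k)) c k) ⟨
      partialSum A (suc k) + c + k + suc c     ≡⟨ cong (λ s → s + k + suc c) sum≡ ⟩
      k * c + k + suc c                        ≡⟨ expand k c ⟩
      suc k * suc c                            ∎
    c+k<1+c+1+k : c + k < suc c + suc k
    c+k<1+c+1+k = s≤s (+-monoʳ-≤ c (n≤1+n k))
    bounded′ : ∀ {i} → i < suc (suc k) → A i < suc c + suc k
    bounded′ i<2+k with m<1+n⇒m<n∨m≡n i<2+k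
    ... | inj₁ i<1+k = <-trans (bounded i<1+k) c+k<1+c+1+k
    ... | inj₂ refl  = subst (_< suc c + suc k) (sym A[1+k]≡c+k) c+k<1+c+1+k

  next-invariant : A (suc k) ≡ proj₁ (next A k c) → Invariant A (suc k) (proj₂ (next A k c))
  next-invariant with used? A (suc k) c
  ... | yes _ = jump-invariant
  ... | no  _ = stay-invariant

-- The terms A 0, …, A 5; the values from index 6 on are never used.
initial : ℕ → ℕ
initial 0 = 0
initial 1 = 1
initial 2 = 2
initial 3 = 3
initial 4 = 6
initial 5 = 4
initial _ = 0

initial-isLeastAdmissible : ∀ {j} → j < 4 → IsLeastAdmissible initial (2 + j) (initial (2 + j))
initial-isLeastAdmissible = from-yes (allUpTo? (λ j → isLeastAdmissible? initial (2 + j) (initial (2 + j))) 4)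

invariant-initial : AgreeBelow A initial 6 → Invariant A 5 4
invariant-initial {A} A≗initial = record
  { sum≡    = cong (_+ 4) (partialSum-cong A≗initial)
  ; c<k     = ≤-refl
  ; bounded = λ i<6 → subst (_< 9) (sym (A≗initial i<6)) (initial<9 i<6)
  }
  where
  initial<9 : ∀ {i} → i < 6 → initial i < 9
  initial<9 = from-yes (allUpTo? (λ i → initial i <? 9) 6)

gap : (ℕ → ℕ) → ℕ → ℕ
gap A zero    = 4
gap A (suc j) = proj₂ (next A (5 + j) (gap A j))

GapStep : (ℕ → ℕ) → ℕ → Set
GapStep A j = A (6 + j) ≡ proj₁ (next A (5 + j) (gap A j))

record FollowsGapRule (A : ℕ → ℕ) : Set where
  field
    agreeBelow-initial : AgreeBelow A initial 6
    gapStep            : ∀ j → GapStep A j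

gap-cong : ∀ j → AgreeBelow A B (5 + j) → gap A j ≡ gap B j
gap-cong zero    A≗B = refl
gap-cong {A} {B} (suc j) A≗B = cong proj₂ (begin
  next A (5 + j) (gap A j) ≡⟨ cong (next A (5 + j)) (gap-cong j (agreeBelow-≤ (n≤1+n (5 + j)) A≗B)) ⟩
  next A (5 + j) (gap B j) ≡⟨ next-cong A≗B ⟩
  next B (5 + j) (gap B j) ∎)
  where open ≡-Reasoning

invariant-gap : AgreeBelow A initial 6 → (∀ j → Invariant A (5 + j) (gap A j) → GapStep A j) →
                ∀ j → Invariant A (5 + j) (gap A j)
invariant-gap A≗initial step zero    = invariant-initial A≗initial
invariant-gap A≗initial step (suc j) = next-invariant inv (step j inv)
  where inv = invariant-gap A≗initial step j

module _ (isQuet : IsQuet A) where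
  private
    least : ∀ m → 2 ≤ m → IsLeastAdmissible A m (A m)
    least = proj₂ (proj₂ isQuet)

  quet-isLeastAdmissible⇒≡ : 2 ≤ m → IsLeastAdmissible A m v → A m ≡ v
  quet-isLeastAdmissible⇒≡ {m} {v} 2≤m (admissible , below-v) with <-cmp (A m) v
  ... | tri< Am<v _ _ = contradiction (proj₁ (least m 2≤m)) (below-v (A m) Am<v)
  ... | tri≈ _ Am≡v _ = Am≡v
  ... | tri> _ _ v<Am = contradiction admissible (proj₂ (least m 2≤m) v v<Am)

  quet-agreeBelow-initial : AgreeBelow A initial 6
  quet-agreeBelow-initial = agreeBelow-initial 4 ≤-refl
    where
    agreeBelow-initial : ∀ j → j ≤ 4 → AgreeBelow A initial (2 + j)
    agreeBelow-initial zero    _   {0} _ = proj₁ isQuet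
    agreeBelow-initial zero    _   {1} _ = proj₁ (proj₂ isQuet)
    agreeBelow-initial zero    _   {2+ _} (s≤s (s≤s ()))
    agreeBelow-initial (suc j) j<4 = agreeBelow-suc A≗initial
      (quet-isLeastAdmissible⇒≡ (m≤m+n 2 j) (isLeastAdmissible-cong A≗initial (initial-isLeastAdmissible j<4)))
      where A≗initial = agreeBelow-initial j (<⇒≤ j<4)

  quet⇒followsGapRule : FollowsGapRule A
  quet⇒followsGapRule = record
    { agreeBelow-initial = quet-agreeBelow-initial
    ; gapStep            = λ j → step j (invariants j)
    }
    where
    step : ∀ j → Invariant A (5 + j) (gap A j) → GapStep A j
    step j inv = quet-isLeastAdmissible⇒≡ (s≤s (s≤s z≤n)) (next-isLeastAdmissible inv)
    invariants : ∀ j → Invariant A (5 + j) (gap A j)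
    invariants = invariant-gap quet-agreeBelow-initial step

  quet-<⇒≢ : x < y → A x ≢ A y
  quet-<⇒≢ {0}     {1}        _   A0≡A1 = 0≢1+n (trans (sym (proj₁ isQuet)) (trans A0≡A1 (proj₁ (proj₂ isQuet))))
  quet-<⇒≢ {suc _} {1}        (s≤s ())
  quet-<⇒≢ {x}     {2+ y}     x<y = proj₁ (proj₁ (least (2 + y) (s≤s (s≤s z≤n)))) x x<y

  quet-injective : Injective _≡_ _≡_ A
  quet-injective {x} {y} Ax≡Ay with <-cmp x y
  ... | tri< x<y _ _ = contradiction Ax≡Ay (quet-<⇒≢ x<y)
  ... | tri≈ _ x≡y _ = x≡y
  ... | tri> _ _ y<x = contradiction (sym Ax≡Ay) (quet-<⇒≢ y<x)

followsGapRule⇒quet : FollowsGapRule A → IsQuet A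
followsGapRule⇒quet {A} rule = A≗initial z<s , A≗initial (s<s z<s) , least
  where
  open FollowsGapRule rule renaming (agreeBelow-initial to A≗initial; gapStep to step)
  least : ∀ m → 2 ≤ m → IsLeastAdmissible A m (A m)
  least 1 (s≤s ())
  least (2+ j) _ with j <? 4
  ... | yes j<4 = subst (IsLeastAdmissible A (2 + j)) (sym (A≗initial (s≤s (s≤s j<4))))
    (isLeastAdmissible-cong (agreeBelow-≤ (s≤s (s≤s (<⇒≤ j<4))) A≗initial) (initial-isLeastAdmissible j<4))
  ... | no j≮4 with i , refl ← m≤n⇒∃[o]m+o≡n (≮⇒≥ j≮4) =
    subst (IsLeastAdmissible A (6 + i)) (sym (step i))
      (next-isLeastAdmissible (invariant-gap A≗initial (λ j _ → step j) i))

module _ (rule : FollowsGapRule A) where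
  open FollowsGapRule rule renaming (agreeBelow-initial to A≗initial; gapStep to step)

  gap-attained : ∀ j → ∃ λ i → A i ≡ gap A j
  gap-attained j with used? A (6 + j) (gap A j)
  ... | yes (i , _ , Ai≡gap) = i , Ai≡gap
  ... | no unused = 6 + j , trans (step j) (cong proj₁ (next-stay unused))

  gap-suc-attained : ∀ j → ∃ λ j′ → gap A j′ ≡ suc (gap A j)
  gap-suc-attained j with used? A (6 + j) (gap A j)
  ... | yes used  = suc j , cong proj₂ (next-jump used)
  ... | no unused = 2 + j , trans (cong proj₂ (next-jump used-next)) (cong suc stays)
    where
    stays : gap A (suc j) ≡ gap A j
    stays = cong proj₂ (next-stay unused)
    used-next : Used A (7 + j) (gap A (suc j))
    used-next = 6 + j , ≤-refl , trans (step j) (trans (cong proj₁ (next-stay unused)) (sym stays))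

  followsGapRule-surjective : Surjective _≡_ _≡_ A
  followsGapRule-surjective = strictlySurjective⇒surjective attained
    where
    attained : StrictlySurjective _≡_ A
    attained 0 = 0 , A≗initial (s≤s z≤n)
    attained 1 = 1 , A≗initial (s≤s (s≤s z≤n))
    attained 2 = 2 , A≗initial (s≤s (s≤s (s≤s z≤n)))
    attained 3 = 3 , A≗initial (s≤s (s≤s (s≤s (s≤s z≤n))))
    attained (suc (suc (suc (suc d))))
      with j , gap≡4+d ← suc-closed⇒attains-above (gap A) gap-suc-attained d
      with i , Ai≡gap ← gap-attained j = i , trans Ai≡gap gap≡4+d

update : (ℕ → ℕ) → ℕ → ℕ → ℕ → ℕ
update A m v i with i ≟ m
... | yes _ = v
... | no  _ = A i

update-≡ : update A m v m ≡ v
update-≡ {m = m} with m ≟ m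
... | yes _  = refl
... | no m≢m = contradiction refl m≢m

update-≢ : ∀ {i} → i ≢ m → update A m v i ≡ A i
update-≢ {m = m} {i = i} i≢m with i ≟ m
... | yes i≡m = contradiction i≡m i≢m
... | no _    = refl

-- prefix j holds the first 6 + j terms; later stages only overwrite larger positions.
prefix : ℕ → ℕ → ℕ
prefix zero    = initial
prefix (suc j) = update (prefix j) (6 + j) (proj₁ (next (prefix j) (5 + j) (gap (prefix j) j)))

prefix-suc : ∀ {i j} → i < 6 + j → prefix (suc j) i ≡ prefix j i
prefix-suc {i} {j} i<6+j = update-≢ {m = 6 + j} {A = prefix j} (<⇒≢ i<6+j)

prefix-stable : ∀ {i j j′} → j ≤ j′ → i < 6 + j → prefix j′ i ≡ prefix j i
prefix-stable {j′ = zero}  z≤n    _ = refl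
prefix-stable {j′ = suc j′} j≤1+j′ i<6+j with m≤n⇒m<n∨m≡n j≤1+j′
... | inj₂ refl  = refl
... | inj₁ j<1+j′ = trans (prefix-suc (<-≤-trans i<6+j (+-monoʳ-≤ 6 j≤j′))) (prefix-stable j≤j′ i<6+j)
  where j≤j′ = s≤s⁻¹ j<1+j′

quetSequence : ℕ → ℕ
quetSequence i = prefix i i

quetSequence≗prefix : ∀ {i j} → i < 6 + j → quetSequence i ≡ prefix j i
quetSequence≗prefix {i} {j} i<6+j with ≤-total i j
... | inj₁ i≤j = sym (prefix-stable i≤j (m≤n+m (suc i) 5))
... | inj₂ j≤i = prefix-stable j≤i i<6+j

quetSequence-followsGapRule : FollowsGapRule quetSequence
quetSequence-followsGapRule = record { agreeBelow-initial = quetSequence≗prefix ; gapStep = step }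
  where
  step : ∀ j → GapStep quetSequence j
  step j = begin
    quetSequence (6 + j)                                   ≡⟨ quetSequence≗prefix (+-monoʳ-< 6 (n<1+n j)) ⟩
    prefix (suc j) (6 + j)                                 ≡⟨ update-≡ {A = prefix j} {m = 6 + j} ⟩
    proj₁ (next (prefix j) (5 + j) (gap (prefix j) j))     ≡⟨ cong proj₁ (next-cong prefix≗quetSequence) ⟩
    proj₁ (next quetSequence (5 + j) (gap (prefix j) j))   ≡⟨ cong (proj₁ ∘ next quetSequence (5 + j))
                                                                (gap-cong j (agreeBelow-≤ (n≤1+n (5 + j)) prefix≗quetSequence)) ⟩
    proj₁ (next quetSequence (5 + j) (gap quetSequence j)) ∎
    where
    open ≡-Reasoning
    prefix≗quetSequence : AgreeBelow (prefix j) quetSequence (6 + j)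
    prefix≗quetSequence = agreeBelow-sym quetSequence≗prefix

theorem9 : ∃ IsQuet × ((A : ℕ → ℕ) → IsQuet A → Bijective {A = ℕ} {B = ℕ} _≡_ _≡_ A)
theorem9 = (quetSequence , followsGapRule⇒quet quetSequence-followsGapRule) ,
           λ A isQuet → quet-injective isQuet , followsGapRule-surjective (quet⇒followsGapRule isQuet)
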